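{- Let $(\Psi_d)_d$ be a constraint structure with a lift, equipped with a binary operation $\wedge$, a compatibility relation $\epsilon$, a witness builder $W$, a ground validity predicate $\models$, a constraint-producing predicate $(\models^d)_d$, a constraint-refining predicate $(\mathcal R^d)_d$ (defining SDI) and a predicate $P$, such that all the axioms (Proj), (Witness), (Meet), (Rel), (Lift), (P1), (P2), (RP), (PR) hold. Let $\Gamma$ be a context of domain $d_0$. (1) If $\sigma\to\vdash^{d_0}\Gamma\to\sigma'$ is derivable in SDI and $\emptyset\,\epsilon\,\sigma'$, then $\vdash\Gamma$ is derivable in LK1. (2) In particular, when $P$ is the predicate "being satisfiable", if $\sigma\to\vdash^{d_0}\Gamma\to\sigma'$ is derivable in SDI, then $\vdash\Gamma$ is derivable in LK1. (3) Assume $P$ is always true or is "being satisfiable". If $\vdash\Gamma$ is derivable in LK1, then for all $\sigma\in\Psi_{d_0}$ with $\emptyset\,\epsilon\,\sigma$ and for all sequentialisations $r$, there exists $\sigma'\in\Psi_{d_0}$ such that $\emptyset\,\epsilon\,\sigma'$ and $\sigma\to\vdash^{d_0}\Gamma\to\sigma'$ is derivable in SDI with a proof tree that follows $r$.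
   Context: Formulae: first-order, negation normal form (literals, $\wedge,\vee,\forall,\exists$). Eigenvariables $\bar x$, meta-variables $X$. Domains: initial domain $d_0$ (no meta-variables); $d;\bar x$ (resp. $d;X$) extends $d$ by a fresh eigenvariable (meta-variable). Terms/formulae of domain $d$ have (free) variables among those declared in $d$; ground = no meta-variable; $T_d$ = ground terms of domain $d$. A context of domain $d$: multiset of formulae of domain $d$; $\Gamma_{lit}$ its set of literals. Instantiations: $\mathrm{Inst}_{d_0}=\{\emptyset\}$, $\mathrm{Inst}_{d;\bar x}=\mathrm{Inst}_d$, $\mathrm{Inst}_{d;X}=\{\rho\cup\{X\mapsto t\}\mid t\in T_d,\rho\in\mathrm{Inst}_d\}$; $\rho(\cdot)$ substitutes meta-variables. Constraint structure: sets $(\Psi_d)_d$, $\Psi_{d;\bar x}=\Psi_d$, projections $\Psi_{d;X}\to\Psi_d$, $\sigma\mapsto\sigma{\downarrow}$, lifts $\Psi_d\to\Psi_{d;X}$, $\sigma\mapsto\sigma{\uparrow}$. Compatibility relation: $\rho\,\epsilon\,\sigma$ for $\rho\in\mathrm{Inst}_d,\sigma\in\Psi_d$; $\sigma$ is satisfiable iff some $\rho\in\mathrm{Inst}_d$ has $\rho\,\epsilon\,\sigma$. Witness builder: $\sigma\in\Psi_{d;X}\mapsto W_\sigma:\mathrm{Inst}_d\to T_d$. Ground validity predicate $\models$ on sets of ground literals. Constraint-producing predicate: $\mathcal A\models^d\sigma$. Constraint-refining predicate: $\mathcal R^d(\sigma,\mathcal A,\sigma')$. $\sigma\preceq_\epsilon\sigma'$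 iff every $\rho$ with $\rho\,\epsilon\,\sigma$ has $\rho\,\epsilon\,\sigma'$; $\equiv_\epsilon$ the associated equivalence. Axioms (all $d$, $\rho\in\mathrm{Inst}_d$): (Proj) $\sigma\in\Psi_{d;X}$, $t\in T_d$: $(\rho\cup\{X\mapsto t\})\,\epsilon\,\sigma\Rightarrow\rho\,\epsilon\,\sigma{\downarrow}$. (Witness) $\sigma\in\Psi_{d;X}$: $\rho\,\epsilon\,\sigma{\downarrow}\Rightarrow(\rho\cup\{X\mapsto W_\sigma(\rho)\})\,\epsilon\,\sigma$. (Meet) ($\rho\,\epsilon\,\sigma$ and $\rho\,\epsilon\,\sigma'$) iff $\rho\,\epsilon\,(\sigma\wedge\sigma')$. (Rel) $\{\rho\mid\ \models\rho(\mathcal A)\}=\bigcup_{\sigma:\mathcal A\models^d\sigma}\{\rho\mid\rho\,\epsilon\,\sigma\}$ for sets $\mathcal A$ of literals of domain $d$. (Lift) $\sigma\in\Psi_d,\sigma'\in\Psi_{d;X}$: $(\rho\cup\{X\mapsto W_{\sigma'}(\rho)\})\,\epsilon\,\sigma{\uparrow}\Leftrightarrow\rho\,\epsilon\,\sigma$. (P1) $\sigma\in\Psi_{d;X}$: $P(\sigma)\Leftrightarrow P(\sigma{\downarrow})$. (P2) $P(\sigma)$, $\sigma\preceq_\epsilon\sigma'$ imply $P(\sigma')$. (RP) $\mathcal R^d(\sigma,\mathcal A,\sigma')\Rightarrow\exists\sigma''$: $\sigma'\equiv_\epsilon\sigma\wedge\sigma''$, $P(\sigma\wedge\sigma'')$,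 $\mathcal A\models^d\sigma''$. (PR) $P(\sigma\wedge\sigma')$ and $\mathcal A\models^d\sigma'$ imply $\exists\sigma''$: $\sigma''\equiv_\epsilon\sigma\wedge\sigma'$, $\mathcal R^d(\sigma,\mathcal A,\sigma'')$. LK1 rules: $\vdash\Gamma$ if $\models\Gamma_{lit}$; from $\vdash\Gamma,A$ and $\vdash\Gamma,B$ infer $\vdash\Gamma,A\wedge B$; from $\vdash\Gamma,A,B$ infer $\vdash\Gamma,A\vee B$; from $\vdash\Gamma,A[x:=t],\exists xA$ infer $\vdash\Gamma,\exists xA$ (any term $t$); from $\vdash\Gamma,A[x:=\bar x]$ infer $\vdash\Gamma,\forall xA$ ($\bar x$ fresh eigenvariable). SDI rules (sequents $\sigma\to\vdash^d\Gamma\to\sigma'$): axiom if $\mathcal R^d(\sigma,\Gamma_{lit},\sigma')$; from $\sigma\to\vdash^d\Gamma,A,B\to\sigma'$ infer $\sigma\to\vdash^d\Gamma,A\vee B\to\sigma'$; for $i\in\{0,1\}$, from $\sigma\to\vdash^d\Gamma,A_i\to\sigma''$ and $\sigma''\to\vdash^d\Gamma,A_{1-i}\to\sigma'$ infer $\sigma\to\vdash^d\Gamma,A_0\wedge A_1\to\sigma'$; from $\sigma{\uparrow}\to\vdash^{d;X}\Gamma,A[x:=X],\exists xA\to\sigma'$ infer $\sigma\to\vdash^d\Gamma,\exists xA\to\sigma'{\downarrow}$ ($X$ fresh); from $\sigma\to\vdash^{d;\bar x}\Gamma,A[x:=\bar x]\to\sigma'$ infer $\sigma\to\vdash^d\Gamma,\forall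 xA\to\sigma'$ ($\bar x$ fresh). A sequentialisation is an infinite binary tree with nodes labelled black or white. An SDI proof tree $\pi$ follows $r$: if its last rule has no premiss, always; if one premiss, iff its sub-tree follows $r$; if its last rule is the $\wedge$ rule with index $i$, with sub-trees $\pi_i$ (first premiss) and $\pi_{1-i}$ (second premiss), iff $\pi_i$ follows the left subtree of $r$, $\pi_{1-i}$ follows the right subtree of $r$, and either $i=0$ and the root of $r$ is white or $i=1$ and the root of $r$ is black. -}

module Defs where

open import Data.Nat using (ℕ; zero; suc)
open import Data.Fin using (Fin; zero; suc)
open import Data.Maybe using (Maybe; just; nothing)
import Data.Maybe as Maybe
open import Data.Bool using (Bool; true; false; not)
open import Data.List using (List; []; _∷_; _++_; map)
open import Data.Vec using (Vec; []; _∷_)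
open import Data.Product using (Σ; _×_; _,_)
open import Data.Sum using (_⊎_)
open import Data.Unit using (⊤; tt)
open import Function using (_∘_; id)
open import Function.Bundles using (_⇔_)
open import Relation.Binary.PropositionalEquality using (_≡_)

-- Domains: d₀ (no variables), d ▷ē (fresh eigenvariable), d ▷X (fresh
-- meta-variable).

data Dom : Set where
  d₀  : Dom
  _▷ē : Dom → Dom
  _▷X : Dom → Dom

data Var : Dom → Set where
  ēnew : ∀ {d} → Var (d ▷ē)
  ēold : ∀ {d} → Var d → Var (d ▷ē)
  Xnew : ∀ {d} → Var (d ▷X)
  Xold : ∀ {d} → Var d → Var (d ▷X)

-- Number of eigenvariables of a domain; ground terms of domain d have
-- their variables in Fin (neig d) (the most recent eigenvariable is zero).
neig : Dom → ℕ
neig d₀ = zero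
neig (d ▷ē) = suc (neig d)
neig (d ▷X) = neig d

record Signature : Set₁ where
  field
    FSym : Set
    far  : FSym → ℕ
    PSym : Set
    par  : PSym → ℕ

-- Sequentialisations: infinite binary trees with black/white nodes,
-- given as colouring of paths from the root.
data Colour : Set where
  black white : Colour

data Dir : Set where
  left right : Dir

Sequentialisation : Set
Sequentialisation = List Dir → Colour

leftSub : Sequentialisation → Sequentialisation
leftSub r p = r (left ∷ p)

rightSub : Sequentialisation → Sequentialisation
rightSub r p = r (right ∷ p)

pick : {A : Set} → Bool → A → A → A
pick false a₀ a₁ = a₀
pick true  a₀ a₁ = a₁

module Syntax (S : Signature) where
  open Signature S

  data Tm (V : Set) : Set where
    var : V → Tm V
    fn  : (f : FSym) → Vec (Tm V) (far f) → Tm V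

  data Lit (V : Set) : Set where
    pos : (p : PSym) → Vec (Tm V) (par p) → Lit V
    neg : (p : PSym) → Vec (Tm V) (par p) → Lit V

  -- formulae in negation normal form; binders via Maybe (nothing = bound var)
  infixr 7 _∧'_
  infixr 6 _∨'_
  data Fm (V : Set) : Set where
    atom  : Lit V → Fm V
    _∧'_  : Fm V → Fm V → Fm V
    _∨'_  : Fm V → Fm V → Fm V
    ∀' ∃' : Fm (Maybe V) → Fm V

  mutual
    substTm : ∀ {V W : Set} → (V → Tm W) → Tm V → Tm W
    substTm s (var x) = s x
    substTm s (fn f ts) = fn f (substTms s ts)

    substTms : ∀ {V W : Set} {n} → (V → Tm W) → Vec (Tm V) n → Vec (Tm W) n
    substTms s [] = []
    substTms s (t ∷ ts) = substTm s t ∷ substTms s ts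

  renTm : ∀ {V W : Set} → (V → W) → Tm V → Tm W
  renTm f = substTm (var ∘ f)

  substLit : ∀ {V W : Set} → (V → Tm W) → Lit V → Lit W
  substLit s (pos p ts) = pos p (substTms s ts)
  substLit s (neg p ts) = neg p (substTms s ts)

  liftS : ∀ {V W : Set} → (V → Tm W) → Maybe V → Tm (Maybe W)
  liftS s nothing = var nothing
  liftS s (just v) = renTm just (s v)

  substFm : ∀ {V W : Set} → (V → Tm W) → Fm V → Fm W
  substFm s (atom l) = atom (substLit s l)
  substFm s (A ∧' B) = substFm s A ∧' substFm s B
  substFm s (A ∨' B) = substFm s A ∨' substFm s B
  substFm s (∀' A) = ∀' (substFm (liftS s) A)
  substFm s (∃' A) = ∃' (substFm (liftS s) A)

  renFm : ∀ {V W : Set} → (V → W) → Fm V → Fm W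
  renFm f = substFm (var ∘ f)

  -- open A (body of a binder over V) into W: free variables renamed by f,
  -- bound variable replaced by t.  A[x:=t] is  open1 id t A.
  open1 : ∀ {V W : Set} → (V → W) → Tm W → Fm (Maybe V) → Fm W
  open1 {V} {W} f t = substFm s
    where
    s : Maybe V → Tm W
    s nothing = t
    s (just v) = var (f v)

  lits : ∀ {V : Set} → List (Fm V) → List (Lit V)
  lits [] = []
  lits (atom l ∷ Γ) = l ∷ lits Γ
  lits (_ ∷ Γ) = lits Γ

  GTm : Dom → Set
  GTm d = Tm (Fin (neig d))

  Inst : Dom → Set
  Inst d₀ = ⊤
  Inst (d ▷ē) = Inst d
  Inst (d ▷X) = Inst d × GTm d

  inst : ∀ {d} → Inst d → Var d → GTm d
  inst {d ▷ē} ρ ēnew = var zero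
  inst {d ▷ē} ρ (ēold v) = renTm suc (inst ρ v)
  inst {d ▷X} (ρ , t) Xnew = t
  inst {d ▷X} (ρ , t) (Xold v) = inst ρ v

  instLit : ∀ {d} → Inst d → Lit (Var d) → Lit (Fin (neig d))
  instLit ρ = substLit (inst ρ)

  instFm : ∀ {d} → Inst d → Fm (Var d) → Fm (Fin (neig d))
  instFm ρ = substFm (inst ρ)

  -- families indexed by domains that are unchanged by adding an eigenvariable
  Ψof : Set → (Dom → Set) → Dom → Set
  Ψof Ψ₀ ΨX d₀ = Ψ₀
  Ψof Ψ₀ ΨX (d ▷ē) = Ψof Ψ₀ ΨX d
  Ψof Ψ₀ ΨX (d ▷X) = ΨX d

  εof : {Ψ₀ : Set} {ΨX : Dom → Set} → (Ψ₀ → Set) →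
        ((d : Dom) → Inst d → GTm d → ΨX d → Set) →
        (d : Dom) → Inst d → Ψof Ψ₀ ΨX d → Set
  εof ε₀ εX d₀ ρ σ = ε₀ σ
  εof ε₀ εX (d ▷ē) ρ σ = εof ε₀ εX d ρ σ
  εof ε₀ εX (d ▷X) (ρ , t) σ = εX d ρ t σ

  meetOf : {Ψ₀ : Set} {ΨX : Dom → Set} → (Ψ₀ → Ψ₀ → Ψ₀) →
           ((d : Dom) → ΨX d → ΨX d → ΨX d) →
           (d : Dom) → Ψof Ψ₀ ΨX d → Ψof Ψ₀ ΨX d → Ψof Ψ₀ ΨX d
  meetOf m₀ mX d₀ = m₀
  meetOf m₀ mX (d ▷ē) = meetOf m₀ mX d
  meetOf m₀ mX (d ▷X) = mX d

  predOf : {Ψ₀ : Set} {ΨX : Dom → Set} → (Ψ₀ → Set) →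
           ((d : Dom) → ΨX d → Set) → (d : Dom) → Ψof Ψ₀ ΨX d → Set
  predOf P₀ PX d₀ = P₀
  predOf P₀ PX (d ▷ē) = predOf P₀ PX d
  predOf P₀ PX (d ▷X) = PX d

  -- The data of a constraint structure with a lift, ∧, ε, W, ⊨, ⊨ᵈ, Rᵈ, P.
  -- Ψ_{d;x̄} = Ψ_d (and likewise ε, ∧, P) holds definitionally via the
  -- recursive families above: Ψ₀ = Ψ_{d₀}, ΨX d = Ψ_{d;X}.
  record ConstraintStructure : Set₁ where
    field
      Ψ₀   : Set
      ΨX   : Dom → Set
      ε₀   : Ψ₀ → Set                                   -- ∅ ε σ
      εX   : (d : Dom) → Inst d → GTm d → ΨX d → Set  -- (ρ ∪ {X↦t}) ε σ
      meet₀ : Ψ₀ → Ψ₀ → Ψ₀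
      meetX : (d : Dom) → ΨX d → ΨX d → ΨX d
      P₀   : Ψ₀ → Set
      PX   : (d : Dom) → ΨX d → Set
    Ψ : Dom → Set
    Ψ = Ψof Ψ₀ ΨX
    field
      proj  : (d : Dom) → ΨX d → Ψ d
      lift  : (d : Dom) → Ψ d → ΨX d
      W     : (d : Dom) → ΨX d → Inst d → GTm d
      ⊨     : (n : ℕ) → List (Lit (Fin n)) → Set
      ⊨ᵈ    : (d : Dom) → List (Lit (Var d)) → Ψ d → Set
      R     : (d : Dom) → Ψ d → List (Lit (Var d)) → Ψ d → Set

  module CS (C : ConstraintStructure) where
    open ConstraintStructure C public

    ε : (d : Dom) → Inst d → Ψ d → Set
    ε = εof ε₀ εX

    ∧ᶜ : (d : Dom) → Ψ d → Ψ d → Ψ d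
    ∧ᶜ = meetOf meet₀ meetX

    P : (d : Dom) → Ψ d → Set
    P = predOf P₀ PX

    Satisfiable : (d : Dom) → Ψ d → Set
    Satisfiable d σ = Σ (Inst d) λ ρ → ε d ρ σ

    ≼ε : (d : Dom) → Ψ d → Ψ d → Set
    ≼ε d σ σ' = (ρ : Inst d) → ε d ρ σ → ε d ρ σ'

    ≡ε : (d : Dom) → Ψ d → Ψ d → Set
    ≡ε d σ σ' = ≼ε d σ σ' × ≼ε d σ' σ

    record Axioms : Set where
      field
        Proj    : (d : Dom) (ρ : Inst d) (σ : ΨX d) (t : GTm d) →
                  ε (d ▷X) (ρ , t) σ → ε d ρ (proj d σ)
        Witness : (d : Dom) (ρ : Inst d) (σ : ΨX d) →
                  ε d ρ (proj d σ) → ε (d ▷X) (ρ , W d σ ρ) σ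
        Meet    : (d : Dom) (ρ : Inst d) (σ σ' : Ψ d) →
                  (ε d ρ σ × ε d ρ σ') ⇔ ε d ρ (∧ᶜ d σ σ')
        Rel     : (d : Dom) (A : List (Lit (Var d))) (ρ : Inst d) →
                  ⊨ (neig d) (map (instLit ρ) A)
                    ⇔ Σ (Ψ d) (λ σ → ⊨ᵈ d A σ × ε d ρ σ)
        Lift    : (d : Dom) (ρ : Inst d) (σ : Ψ d) (σ' : ΨX d) →
                  ε (d ▷X) (ρ , W d σ' ρ) (lift d σ) ⇔ ε d ρ σ
        P1      : (d : Dom) (σ : ΨX d) → P (d ▷X) σ ⇔ P d (proj d σ)
        P2      : (d : Dom) (σ σ' : Ψ d) → P d σ → ≼ε d σ σ' → P d σ'
        RP      : (d : Dom) (σ σ' : Ψ d) (A : List (Lit (Var d))) →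
                  R d σ A σ' →
                  Σ (Ψ d) λ σ'' → ≡ε d σ' (∧ᶜ d σ σ'') × P d (∧ᶜ d σ σ'') × ⊨ᵈ d A σ''
        PR      : (d : Dom) (σ σ' : Ψ d) (A : List (Lit (Var d))) →
                  P d (∧ᶜ d σ σ') → ⊨ᵈ d A σ' →
                  Σ (Ψ d) λ σ'' → ≡ε d σ'' (∧ᶜ d σ σ') × R d σ A σ''

    -- LK1 (ground sequents over n eigenvariables); the principal formula
    -- may sit anywhere in the context (contexts are multisets).
    data LK1 : (n : ℕ) → List (Fm (Fin n)) → Set where
      ax  : ∀ {n Γ} → ⊨ n (lits Γ) → LK1 n Γ
      ∧r  : ∀ {n} (Γ Δ : List (Fm (Fin n))) {A B} →
            LK1 n (Γ ++ A ∷ Δ) → LK1 n (Γ ++ B ∷ Δ) → LK1 n (Γ ++ (A ∧' B) ∷ Δ)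
      ∨r  : ∀ {n} (Γ Δ : List (Fm (Fin n))) {A B} →
            LK1 n (Γ ++ A ∷ B ∷ Δ) → LK1 n (Γ ++ (A ∨' B) ∷ Δ)
      ∃r  : ∀ {n} (Γ Δ : List (Fm (Fin n))) {A} (t : Tm (Fin n)) →
            LK1 n (Γ ++ open1 id t A ∷ ∃' A ∷ Δ) → LK1 n (Γ ++ ∃' A ∷ Δ)
      ∀r  : ∀ {n} (Γ Δ : List (Fm (Fin n))) {A} →
            LK1 (suc n) (map (renFm suc) Γ ++ open1 suc (var zero) A ∷ map (renFm suc) Δ) →
            LK1 n (Γ ++ ∀' A ∷ Δ)

    data SDI : (d : Dom) → Ψ d → List (Fm (Var d)) → Ψ d → Set where
      ax  : ∀ {d} {σ : Ψ d} {Γ} {σ' : Ψ d} → R d σ (lits Γ) σ' → SDI d σ Γ σ'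
      ∨r  : ∀ {d} {σ σ' : Ψ d} (Γ Δ : List (Fm (Var d))) {A B} →
            SDI d σ (Γ ++ A ∷ B ∷ Δ) σ' → SDI d σ (Γ ++ (A ∨' B) ∷ Δ) σ'
      ∧r  : ∀ {d} {σ σ'' σ' : Ψ d} (Γ Δ : List (Fm (Var d))) {A₀ A₁} (i : Bool) →
            SDI d σ (Γ ++ pick i A₀ A₁ ∷ Δ) σ'' →
            SDI d σ'' (Γ ++ pick (not i) A₀ A₁ ∷ Δ) σ' →
            SDI d σ (Γ ++ (A₀ ∧' A₁) ∷ Δ) σ'
      ∃r  : ∀ {d} {σ : Ψ d} {σ' : ΨX d} (Γ Δ : List (Fm (Var d))) {A} →
            SDI (d ▷X) (lift d σ)
                (map (renFm Xold) Γ ++ open1 Xold (var Xnew) A ∷ renFm Xold (∃' A)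
                   ∷ map (renFm Xold) Δ) σ' →
            SDI d σ (Γ ++ ∃' A ∷ Δ) (proj d σ')
      ∀r  : ∀ {d} {σ σ' : Ψ d} (Γ Δ : List (Fm (Var d))) {A} →
            SDI (d ▷ē) σ (map (renFm ēold) Γ ++ open1 ēold (var ēnew) A ∷ map (renFm ēold) Δ) σ' →
            SDI d σ (Γ ++ ∀' A ∷ Δ) σ'

    -- a proof tree follows a sequentialisation (index false = 0, true = 1)
    follows : ∀ {d} {σ : Ψ d} {Γ} {σ' : Ψ d} → SDI d σ Γ σ' → Sequentialisation → Set
    follows (ax _) r = ⊤
    follows (∨r Γ Δ π) r = follows π r
    follows (∧r Γ Δ i π₁ π₂) r =
      follows π₁ (leftSub r) × follows π₂ (rightSub r) ×
      ((i ≡ false × r [] ≡ white) ⊎ (i ≡ true × r [] ≡ black))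
    follows (∃r Γ Δ π) r = follows π r
    follows (∀r Γ Δ π) r = follows π r

module Submission where

-- Soundness, parts (1) and (2): by induction on an SDI derivation
-- σ → ⊢ᵈ Γ → σ', every instantiation ρ compatible with σ' is compatible
-- with σ and makes ρΓ derivable in LK1 (at ∃ rules ρ is extended by the
-- witness W_σ'(ρ)).  Every output constraint satisfies P, so when P is
-- satisfiability the hypothesis ∅ ε σ' of part (1) is automatic.
-- Completeness, part (3): by induction on an LK1 derivation of ρΓ we build
-- a residual constraint τ, compatible with ρ, such that from every input σ
-- with P(σ ∧ τ) SDI derives Γ along any sequentialisation, ending in a
-- constraint ≡ε σ ∧ τ.  At d₀ either hypothesis on P gives P(σ ∧ τ).

open import Defs
open import Data.Bool using (Bool; true; false; not)
open import Data.Fin using (zero; suc)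
open import Data.Maybe using (Maybe; just; nothing)
open import Data.List using (List; []; _∷_; _++_; map)
open import Data.List.Properties using (map-++; map-∘; map-cong; ∷-injective)
open import Data.Vec using (Vec; []; _∷_)
open import Data.Product using (Σ; _×_; _,_; proj₁; proj₂)
open import Data.Sum using (_⊎_; inj₁; inj₂)
open import Data.Unit using (tt)
open import Function using (_∘_; id)
open import Function.Bundles using (_⇔_; Equivalence)
open import Relation.Binary.PropositionalEquality

module SubstitutionLaws (S : Signature) where
  open Syntax S

  mutual
    substTm-cong : ∀ {V W : Set} {s s' : V → Tm W} → (∀ v → s v ≡ s' v) →
                   (t : Tm V) → substTm s t ≡ substTm s' t
    substTm-cong e (var x) = e x
    substTm-cong e (fn f ts) = cong (fn f) (substTms-cong e ts)

    substTms-cong : ∀ {V W : Set} {n} {s s' : V → Tm W} → (∀ v → s v ≡ s' v) →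
                    (ts : Vec (Tm V) n) → substTms s ts ≡ substTms s' ts
    substTms-cong e [] = refl
    substTms-cong e (t ∷ ts) = cong₂ _∷_ (substTm-cong e t) (substTms-cong e ts)

  mutual
    substTm-id : ∀ {V : Set} (t : Tm V) → substTm var t ≡ t
    substTm-id (var x) = refl
    substTm-id (fn f ts) = cong (fn f) (substTms-id ts)

    substTms-id : ∀ {V : Set} {n} (ts : Vec (Tm V) n) → substTms var ts ≡ ts
    substTms-id [] = refl
    substTms-id (t ∷ ts) = cong₂ _∷_ (substTm-id t) (substTms-id ts)

  mutual
    substTm-fuse : ∀ {U V W : Set} (s : V → Tm W) (s' : U → Tm V) (t : Tm U) →
                   substTm s (substTm s' t) ≡ substTm (substTm s ∘ s') t
    substTm-fuse s s' (var x) = refl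
    substTm-fuse s s' (fn f ts) = cong (fn f) (substTms-fuse s s' ts)

    substTms-fuse : ∀ {U V W : Set} {n} (s : V → Tm W) (s' : U → Tm V) (ts : Vec (Tm U) n) →
                    substTms s (substTms s' ts) ≡ substTms (substTm s ∘ s') ts
    substTms-fuse s s' [] = refl
    substTms-fuse s s' (t ∷ ts) = cong₂ _∷_ (substTm-fuse s s' t) (substTms-fuse s s' ts)

  substLit-cong : ∀ {V W : Set} {s s' : V → Tm W} → (∀ v → s v ≡ s' v) →
                  (l : Lit V) → substLit s l ≡ substLit s' l
  substLit-cong e (pos p ts) = cong (pos p) (substTms-cong e ts)
  substLit-cong e (neg p ts) = cong (neg p) (substTms-cong e ts)

  substLit-fuse : ∀ {U V W : Set} (s : V → Tm W) (s' : U → Tm V) (l : Lit U) →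
                  substLit s (substLit s' l) ≡ substLit (substTm s ∘ s') l
  substLit-fuse s s' (pos p ts) = cong (pos p) (substTms-fuse s s' ts)
  substLit-fuse s s' (neg p ts) = cong (neg p) (substTms-fuse s s' ts)

  liftS-cong : ∀ {V W : Set} {s s' : V → Tm W} → (∀ v → s v ≡ s' v) →
               ∀ v → liftS s v ≡ liftS s' v
  liftS-cong e nothing = refl
  liftS-cong e (just v) = cong (renTm just) (e v)

  liftS-fuse : ∀ {U V W : Set} (s : V → Tm W) (s' : U → Tm V) →
               ∀ x → substTm (liftS s) (liftS s' x) ≡ liftS (substTm s ∘ s') x
  liftS-fuse s s' nothing = refl
  liftS-fuse s s' (just v) =
    trans (substTm-fuse (liftS s) (var ∘ just) (s' v)) (sym (substTm-fuse (var ∘ just) s (s' v)))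

  substFm-cong : ∀ {V W : Set} {s s' : V → Tm W} → (∀ v → s v ≡ s' v) →
                 (A : Fm V) → substFm s A ≡ substFm s' A
  substFm-cong e (atom l) = cong atom (substLit-cong e l)
  substFm-cong e (A ∧' B) = cong₂ _∧'_ (substFm-cong e A) (substFm-cong e B)
  substFm-cong e (A ∨' B) = cong₂ _∨'_ (substFm-cong e A) (substFm-cong e B)
  substFm-cong e (∀' A) = cong ∀' (substFm-cong (liftS-cong e) A)
  substFm-cong e (∃' A) = cong ∃' (substFm-cong (liftS-cong e) A)

  substFm-fuse : ∀ {U V W : Set} (s : V → Tm W) (s' : U → Tm V) (A : Fm U) →
                 substFm s (substFm s' A) ≡ substFm (substTm s ∘ s') A
  substFm-fuse s s' (atom l) = cong atom (substLit-fuse s s' l)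
  substFm-fuse s s' (A ∧' B) = cong₂ _∧'_ (substFm-fuse s s' A) (substFm-fuse s s' B)
  substFm-fuse s s' (A ∨' B) = cong₂ _∨'_ (substFm-fuse s s' A) (substFm-fuse s s' B)
  substFm-fuse s s' (∀' A) =
    cong ∀' (trans (substFm-fuse (liftS s) (liftS s') A) (substFm-cong (liftS-fuse s s') A))
  substFm-fuse s s' (∃' A) =
    cong ∃' (trans (substFm-fuse (liftS s) (liftS s') A) (substFm-cong (liftS-fuse s s') A))

  substFm-fuse₂ : ∀ {U V₁ V₂ W : Set} (s₁ : V₁ → Tm W) (s₁' : U → Tm V₁)
                  (s₂ : V₂ → Tm W) (s₂' : U → Tm V₂) →
                  (∀ x → substTm s₁ (s₁' x) ≡ substTm s₂ (s₂' x)) → (A : Fm U) →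
                  substFm s₁ (substFm s₁' A) ≡ substFm s₂ (substFm s₂' A)
  substFm-fuse₂ s₁ s₁' s₂ s₂' e A =
    trans (substFm-fuse s₁ s₁' A) (trans (substFm-cong e A) (sym (substFm-fuse s₂ s₂' A)))

  substFm-∧-inv : ∀ {V W : Set} {s : V → Tm W} (Y : Fm V) {A B : Fm W} → substFm s Y ≡ A ∧' B →
                  Σ (Fm V) λ Y₀ → Σ (Fm V) λ Y₁ →
                  Y ≡ Y₀ ∧' Y₁ × substFm s Y₀ ≡ A × substFm s Y₁ ≡ B
  substFm-∧-inv (Y₀ ∧' Y₁) refl = Y₀ , Y₁ , refl , refl , refl
  substFm-∧-inv (atom _) ()
  substFm-∧-inv (_ ∨' _) ()
  substFm-∧-inv (∀' _) ()
  substFm-∧-inv (∃' _) ()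

  substFm-∨-inv : ∀ {V W : Set} {s : V → Tm W} (Y : Fm V) {A B : Fm W} → substFm s Y ≡ A ∨' B →
                  Σ (Fm V) λ Y₀ → Σ (Fm V) λ Y₁ →
                  Y ≡ Y₀ ∨' Y₁ × substFm s Y₀ ≡ A × substFm s Y₁ ≡ B
  substFm-∨-inv (Y₀ ∨' Y₁) refl = Y₀ , Y₁ , refl , refl , refl
  substFm-∨-inv (atom _) ()
  substFm-∨-inv (_ ∧' _) ()
  substFm-∨-inv (∀' _) ()
  substFm-∨-inv (∃' _) ()

  substFm-∀-inv : ∀ {V W : Set} {s : V → Tm W} (Y : Fm V) {A : Fm (Maybe W)} → substFm s Y ≡ ∀' A →
                  Σ (Fm (Maybe V)) λ Y₀ → Y ≡ ∀' Y₀ × substFm (liftS s) Y₀ ≡ A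
  substFm-∀-inv (∀' Y₀) refl = Y₀ , refl , refl
  substFm-∀-inv (atom _) ()
  substFm-∀-inv (_ ∧' _) ()
  substFm-∀-inv (_ ∨' _) ()
  substFm-∀-inv (∃' _) ()

  substFm-∃-inv : ∀ {V W : Set} {s : V → Tm W} (Y : Fm V) {A : Fm (Maybe W)} → substFm s Y ≡ ∃' A →
                  Σ (Fm (Maybe V)) λ Y₀ → Y ≡ ∃' Y₀ × substFm (liftS s) Y₀ ≡ A
  substFm-∃-inv (∃' Y₀) refl = Y₀ , refl , refl
  substFm-∃-inv (atom _) ()
  substFm-∃-inv (_ ∧' _) ()
  substFm-∃-inv (_ ∨' _) ()
  substFm-∃-inv (∀' _) ()

module InstantiationLaws (S : Signature) where
  open Syntax S
  open SubstitutionLaws S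

  instFm-weakenē : ∀ {d} (ρ : Inst d) (B : Fm (Var d)) →
                   instFm {d ▷ē} ρ (renFm ēold B) ≡ renFm suc (instFm ρ B)
  instFm-weakenē {d} ρ = substFm-fuse₂ (inst {d ▷ē} ρ) (var ∘ ēold) (var ∘ suc) (inst ρ) (λ _ → refl)

  instFm-weakenX : ∀ {d} (ρ : Inst d) (t : GTm d) (B : Fm (Var d)) →
                   instFm {d ▷X} (ρ , t) (renFm Xold B) ≡ instFm ρ B
  instFm-weakenX {d} ρ t = substFm-fuse (inst {d ▷X} (ρ , t)) (var ∘ Xold)

  instFm-openē : ∀ {d} (ρ : Inst d) (A : Fm (Maybe (Var d))) →
                 instFm {d ▷ē} ρ (open1 ēold (var ēnew) A)
                 ≡ open1 suc (var zero) (substFm (liftS (inst ρ)) A)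
  instFm-openē {d} ρ = substFm-fuse₂ (inst {d ▷ē} ρ) _ _ (liftS (inst ρ)) agree
    where
    agree : ∀ x → _
    agree nothing = refl
    agree (just v) = sym (substTm-fuse _ (var ∘ just) (inst ρ v))

  instFm-openX : ∀ {d} (ρ : Inst d) (t : GTm d) (A : Fm (Maybe (Var d))) →
                 instFm {d ▷X} (ρ , t) (open1 Xold (var Xnew) A)
                 ≡ open1 id t (substFm (liftS (inst ρ)) A)
  instFm-openX {d} ρ t = substFm-fuse₂ (inst {d ▷X} (ρ , t)) _ _ (liftS (inst ρ)) agree
    where
    agree : ∀ x → _
    agree nothing = refl
    agree (just v) = sym (trans (substTm-fuse _ (var ∘ just) (inst ρ v)) (substTm-id (inst ρ v)))

  lits-inst : ∀ {d} (ρ : Inst d) (Γ : List (Fm (Var d))) →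
              lits (map (instFm ρ) Γ) ≡ map (instLit ρ) (lits Γ)
  lits-inst ρ [] = refl
  lits-inst ρ (atom l ∷ Γ) = cong (instLit ρ l ∷_) (lits-inst ρ Γ)
  lits-inst ρ ((_ ∧' _) ∷ Γ) = lits-inst ρ Γ
  lits-inst ρ ((_ ∨' _) ∷ Γ) = lits-inst ρ Γ
  lits-inst ρ (∀' _ ∷ Γ) = lits-inst ρ Γ
  lits-inst ρ (∃' _ ∷ Γ) = lits-inst ρ Γ

  premiseē-inst : ∀ {d} (ρ : Inst d) (Γ Δ : List (Fm (Var d))) (A : Fm (Maybe (Var d))) →
                  map (instFm {d ▷ē} ρ)
                      (map (renFm ēold) Γ ++ open1 ēold (var ēnew) A ∷ map (renFm ēold) Δ)
                  ≡ map (renFm suc) (map (instFm ρ) Γ)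
                    ++ open1 suc (var zero) (substFm (liftS (inst ρ)) A)
                    ∷ map (renFm suc) (map (instFm ρ) Δ)
  premiseē-inst {d} ρ Γ Δ A = begin
    map (instFm {d ▷ē} ρ) (map (renFm ēold) Γ ++ open1 ēold (var ēnew) A ∷ map (renFm ēold) Δ)
      ≡⟨ map-++ (instFm {d ▷ē} ρ) (map (renFm ēold) Γ) _ ⟩
    map (instFm {d ▷ē} ρ) (map (renFm ēold) Γ)
      ++ instFm {d ▷ē} ρ (open1 ēold (var ēnew) A) ∷ map (instFm {d ▷ē} ρ) (map (renFm ēold) Δ)
      ≡⟨ cong₂ _++_ (weaken Γ) (cong₂ _∷_ (instFm-openē ρ A) (weaken Δ)) ⟩
    map (renFm suc) (map (instFm ρ) Γ)
      ++ open1 suc (var zero) (substFm (liftS (inst ρ)) A) ∷ map (renFm suc) (map (instFm ρ) Δ) ∎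
    where
    open ≡-Reasoning
    weaken : ∀ Θ → map (instFm {d ▷ē} ρ) (map (renFm ēold) Θ) ≡ map (renFm suc) (map (instFm ρ) Θ)
    weaken Θ = trans (sym (map-∘ Θ)) (trans (map-cong (instFm-weakenē ρ) Θ) (map-∘ Θ))

  premiseX-inst : ∀ {d} (ρ : Inst d) (t : GTm d) (Γ Δ : List (Fm (Var d))) (A : Fm (Maybe (Var d))) →
                  map (instFm {d ▷X} (ρ , t))
                      (map (renFm Xold) Γ ++ open1 Xold (var Xnew) A ∷ renFm Xold (∃' A)
                         ∷ map (renFm Xold) Δ)
                  ≡ map (instFm ρ) Γ
                    ++ open1 id t (substFm (liftS (inst ρ)) A) ∷ instFm ρ (∃' A) ∷ map (instFm ρ) Δ
  premiseX-inst {d} ρ t Γ Δ A = begin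
    map (instFm {d ▷X} (ρ , t))
        (map (renFm Xold) Γ ++ open1 Xold (var Xnew) A ∷ renFm Xold (∃' A) ∷ map (renFm Xold) Δ)
      ≡⟨ map-++ (instFm {d ▷X} (ρ , t)) (map (renFm Xold) Γ) _ ⟩
    map (instFm {d ▷X} (ρ , t)) (map (renFm Xold) Γ)
      ++ instFm {d ▷X} (ρ , t) (open1 Xold (var Xnew) A) ∷ instFm {d ▷X} (ρ , t) (renFm Xold (∃' A))
      ∷ map (instFm {d ▷X} (ρ , t)) (map (renFm Xold) Δ)
      ≡⟨ cong₂ _++_ (weaken Γ)
           (cong₂ _∷_ (instFm-openX ρ t A) (cong₂ _∷_ (instFm-weakenX ρ t (∃' A)) (weaken Δ))) ⟩
    map (instFm ρ) Γ
      ++ open1 id t (substFm (liftS (inst ρ)) A) ∷ instFm ρ (∃' A) ∷ map (instFm ρ) Δ ∎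
    where
    open ≡-Reasoning
    weaken : ∀ Θ → map (instFm {d ▷X} (ρ , t)) (map (renFm Xold) Θ) ≡ map (instFm ρ) Θ
    weaken Θ = trans (sym (map-∘ Θ)) (map-cong (instFm-weakenX ρ t) Θ)

map-focus-inv : ∀ {A B : Set} (f : A → B) (Γ : List A) {Γ₁ Δ₁ : List B} {X : B} →
                map f Γ ≡ Γ₁ ++ X ∷ Δ₁ →
                Σ (List A) λ Γa → Σ A λ Y → Σ (List A) λ Δa →
                Γ ≡ Γa ++ Y ∷ Δa × map f Γa ≡ Γ₁ × f Y ≡ X × map f Δa ≡ Δ₁
map-focus-inv f [] {[]} ()
map-focus-inv f [] {_ ∷ _} ()
map-focus-inv f (Y ∷ Γ) {[]} refl = [] , Y , Γ , refl , refl , refl , refl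
map-focus-inv f (Y ∷ Γ) {_ ∷ Γ₁} eq with ∷-injective eq
... | refl , eq' with map-focus-inv f Γ eq'
...   | Γa , Y' , Δa , refl , refl , refl , refl = Y ∷ Γa , Y' , Δa , refl , refl , refl , refl

module InstantiatedLK1 (S : Signature) (C : Syntax.ConstraintStructure S) where
  open Syntax S
  open CS C
  open InstantiationLaws S

  ⊢[_]_ : ∀ {d} → Inst d → List (Fm (Var d)) → Set
  ⊢[_]_ {d} ρ Γ = LK1 (neig d) (map (instFm ρ) Γ)

  unfocus : ∀ {d} (ρ : Inst d) (Γ Δ : List (Fm (Var d))) (X : Fm (Var d)) →
            LK1 (neig d) (map (instFm ρ) Γ ++ instFm ρ X ∷ map (instFm ρ) Δ) → ⊢[ ρ ] (Γ ++ X ∷ Δ)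
  unfocus ρ Γ Δ X = subst (LK1 _) (sym (map-++ (instFm ρ) Γ (X ∷ Δ)))

  focus : ∀ {d} (ρ : Inst d) (Γ Δ : List (Fm (Var d))) (X : Fm (Var d)) →
          ⊢[ ρ ] (Γ ++ X ∷ Δ) → LK1 (neig d) (map (instFm ρ) Γ ++ instFm ρ X ∷ map (instFm ρ) Δ)
  focus ρ Γ Δ X = subst (LK1 _) (map-++ (instFm ρ) Γ (X ∷ Δ))

  inst-ax : ∀ {d} (ρ : Inst d) (Γ : List (Fm (Var d))) →
            ⊨ (neig d) (map (instLit ρ) (lits Γ)) → ⊢[ ρ ] Γ
  inst-ax ρ Γ v = ax (subst (⊨ _) (sym (lits-inst ρ Γ)) v)

  inst-∨r : ∀ {d} (ρ : Inst d) (Γ Δ : List (Fm (Var d))) {A B : Fm (Var d)} →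
            ⊢[ ρ ] (Γ ++ A ∷ B ∷ Δ) → ⊢[ ρ ] (Γ ++ (A ∨' B) ∷ Δ)
  inst-∨r ρ Γ Δ {A} {B} p =
    unfocus ρ Γ Δ (A ∨' B) (∨r _ _ (subst (LK1 _) (map-++ (instFm ρ) Γ (A ∷ B ∷ Δ)) p))

  inst-∧r : ∀ {d} (ρ : Inst d) (Γ Δ : List (Fm (Var d))) {A₀ A₁ : Fm (Var d)} (i : Bool) →
            ⊢[ ρ ] (Γ ++ pick i A₀ A₁ ∷ Δ) → ⊢[ ρ ] (Γ ++ pick (not i) A₀ A₁ ∷ Δ) →
            ⊢[ ρ ] (Γ ++ (A₀ ∧' A₁) ∷ Δ)
  inst-∧r ρ Γ Δ {A₀} {A₁} false p₀ p₁ =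
    unfocus ρ Γ Δ (A₀ ∧' A₁) (∧r _ _ (focus ρ Γ Δ A₀ p₀) (focus ρ Γ Δ A₁ p₁))
  inst-∧r ρ Γ Δ {A₀} {A₁} true p₁ p₀ =
    unfocus ρ Γ Δ (A₀ ∧' A₁) (∧r _ _ (focus ρ Γ Δ A₀ p₀) (focus ρ Γ Δ A₁ p₁))

  inst-∃r : ∀ {d} (ρ : Inst d) (t : GTm d) (Γ Δ : List (Fm (Var d))) {A : Fm (Maybe (Var d))} →
            ⊢[_]_ {d ▷X} (ρ , t)
              (map (renFm Xold) Γ ++ open1 Xold (var Xnew) A ∷ renFm Xold (∃' A) ∷ map (renFm Xold) Δ) →
            ⊢[ ρ ] (Γ ++ ∃' A ∷ Δ)
  inst-∃r ρ t Γ Δ {A} p =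
    unfocus ρ Γ Δ (∃' A) (∃r _ _ t (subst (LK1 _) (premiseX-inst ρ t Γ Δ A) p))

  inst-∀r : ∀ {d} (ρ : Inst d) (Γ Δ : List (Fm (Var d))) {A : Fm (Maybe (Var d))} →
            ⊢[_]_ {d ▷ē} ρ (map (renFm ēold) Γ ++ open1 ēold (var ēnew) A ∷ map (renFm ēold) Δ) →
            ⊢[ ρ ] (Γ ++ ∀' A ∷ Δ)
  inst-∀r ρ Γ Δ {A} p =
    unfocus ρ Γ Δ (∀' A) (∀r _ _ (subst (LK1 _) (premiseē-inst ρ Γ Δ A) p))

module ConstraintCalculus (S : Signature) (C : Syntax.ConstraintStructure S)
                          (AX : Syntax.CS.Axioms S C) where
  open Syntax S
  open CS C
  open Axioms AX

  meet-intro : ∀ d {ρ σ τ} → ε d ρ σ → ε d ρ τ → ε d ρ (∧ᶜ d σ τ)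
  meet-intro d {ρ} {σ} {τ} e e' = Equivalence.to (Meet d ρ σ τ) (e , e')

  ≼-trans : ∀ d {a b c : Ψ d} → ≼ε d a b → ≼ε d b c → ≼ε d a c
  ≼-trans d a≼b b≼c ρ = b≼c ρ ∘ a≼b ρ

  ∧-lowerˡ : ∀ d {σ τ : Ψ d} → ≼ε d (∧ᶜ d σ τ) σ
  ∧-lowerˡ d {σ} {τ} ρ e = proj₁ (Equivalence.from (Meet d ρ σ τ) e)

  ∧-lowerʳ : ∀ d {σ τ : Ψ d} → ≼ε d (∧ᶜ d σ τ) τ
  ∧-lowerʳ d {σ} {τ} ρ e = proj₂ (Equivalence.from (Meet d ρ σ τ) e)

  ∧-greatest : ∀ d {a σ τ : Ψ d} → ≼ε d a σ → ≼ε d a τ → ≼ε d a (∧ᶜ d σ τ)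
  ∧-greatest d a≼σ a≼τ ρ e = meet-intro d (a≼σ ρ e) (a≼τ ρ e)

  ∧-comm : ∀ d {σ τ : Ψ d} → ≡ε d (∧ᶜ d σ τ) (∧ᶜ d τ σ)
  ∧-comm d = ∧-greatest d (∧-lowerʳ d) (∧-lowerˡ d) , ∧-greatest d (∧-lowerʳ d) (∧-lowerˡ d)

  ≡ε-refl : ∀ d {σ : Ψ d} → ≡ε d σ σ
  ≡ε-refl d = (λ _ e → e) , (λ _ e → e)

  ≡ε-trans : ∀ d {a b c : Ψ d} → ≡ε d a b → ≡ε d b c → ≡ε d a c
  ≡ε-trans d (a≼b , b≼a) (b≼c , c≼b) = ≼-trans d a≼b b≼c , ≼-trans d c≼b b≼a

  proj-mono : ∀ d {σ τ : ΨX d} → ≼ε (d ▷X) σ τ → ≼ε d (proj d σ) (proj d τ)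
  proj-mono d {σ} {τ} σ≼τ ρ e = Proj d ρ τ (W d σ ρ) (σ≼τ (ρ , W d σ ρ) (Witness d ρ σ e))

  proj-lift-meet : ∀ d (σ : Ψ d) (τ : ΨX d) → ≡ε d (proj d (meetX d (lift d σ) τ)) (∧ᶜ d σ (proj d τ))
  proj-lift-meet d σ τ = to , from
    where
    to : ≼ε d (proj d (meetX d (lift d σ) τ)) (∧ᶜ d σ (proj d τ))
    to ρ e =
      let e' = Witness d ρ (meetX d (lift d σ) τ) e
      in meet-intro d (Equivalence.to (Lift d ρ σ _) (∧-lowerˡ (d ▷X) _ e'))
                      (Proj d ρ τ _ (∧-lowerʳ (d ▷X) _ e'))
    from : ≼ε d (∧ᶜ d σ (proj d τ)) (proj d (meetX d (lift d σ) τ))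
    from ρ e =
      Proj d ρ _ (W d τ ρ)
        (meet-intro (d ▷X) (Equivalence.from (Lift d ρ σ τ) (∧-lowerˡ d ρ e))
                           (Witness d ρ τ (∧-lowerʳ d ρ e)))

module Soundness (S : Signature) (C : Syntax.ConstraintStructure S) (AX : Syntax.CS.Axioms S C) where
  open Syntax S
  open CS C
  open Axioms AX
  open InstantiatedLK1 S C
  open ConstraintCalculus S C AX

  -- At an axiom, (RP) splits σ' into σ and a constraint produced by Γ_lit,
  -- whose compatible instantiations make ρ(Γ_lit) valid by (Rel); at an
  -- ∃ rule the meta-variable is instantiated by the witness W_σ'(ρ).
  sound : ∀ {d σ Γ σ'} → SDI d σ Γ σ' → (ρ : Inst d) → ε d ρ σ' → ε d ρ σ × ⊢[ ρ ] Γ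
  sound (ax {d} {σ} {Γ} {σ'} R) ρ e =
    let σ'' , (σ'≼ , _) , _ , Γ⊨σ'' = RP d σ σ' (lits Γ) R
        e' = σ'≼ ρ e
    in ∧-lowerˡ d ρ e' ,
       inst-ax ρ Γ (Equivalence.from (Rel d (lits Γ) ρ) (σ'' , Γ⊨σ'' , ∧-lowerʳ d ρ e'))
  sound (∨r Γ Δ π) ρ e =
    let e₁ , p = sound π ρ e in e₁ , inst-∨r ρ Γ Δ p
  sound (∧r Γ Δ i π₁ π₂) ρ e =
    let e₂ , p₂ = sound π₂ ρ e
        e₁ , p₁ = sound π₁ ρ e₂
    in e₁ , inst-∧r ρ Γ Δ i p₁ p₂
  sound (∃r {d} {σ} {σ'} Γ Δ π) ρ e =
    let e₁ , p = sound π (ρ , W d σ' ρ) (Witness d ρ σ' e)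
    in Equivalence.to (Lift d ρ σ σ') e₁ , inst-∃r ρ (W d σ' ρ) Γ Δ p
  sound (∀r Γ Δ π) ρ e =
    let e₁ , p = sound π ρ e in e₁ , inst-∀r ρ Γ Δ p

  -- The output constraint of every SDI derivation satisfies P:
  -- (RP) and (P2) at axioms, (P1) at ∃ rules.
  output-P : ∀ {d σ Γ σ'} → SDI d σ Γ σ' → P d σ'
  output-P (ax {d} {σ} {Γ} {σ'} R) =
    let σ'' , (_ , ≼σ') , Pσ∧σ'' , _ = RP d σ σ' (lits Γ) R in P2 d _ σ' Pσ∧σ'' ≼σ'
  output-P (∨r Γ Δ π) = output-P π
  output-P (∧r Γ Δ i π₁ π₂) = output-P π₂
  output-P (∃r {d} {σ} {σ'} Γ Δ π) = Equivalence.to (P1 d σ') (output-P π)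
  output-P (∀r Γ Δ π) = output-P π

module Completeness (S : Signature) (C : Syntax.ConstraintStructure S) (AX : Syntax.CS.Axioms S C) where
  open Syntax S
  open CS C
  open Axioms AX
  open SubstitutionLaws S
  open InstantiationLaws S
  open ConstraintCalculus S C AX

  Reaches : (d : Dom) → Ψ d → List (Fm (Var d)) → Ψ d → Sequentialisation → Set
  Reaches d σ Γ τ r = Σ (Ψ d) λ σ' → ≡ε d σ' (∧ᶜ d σ τ) × Σ (SDI d σ Γ σ') λ π → follows π r

  Completable : (d : Dom) → List (Fm (Var d)) → Ψ d → Set
  Completable d Γ τ = (σ : Ψ d) → P d (∧ᶜ d σ τ) → (r : Sequentialisation) → Reaches d σ Γ τ r

  completable-ax : ∀ {d Γ τ} → ⊨ᵈ d (lits Γ) τ → Completable d Γ τ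
  completable-ax {d} {Γ} {τ} Γ⊨τ σ Pσ∧τ r =
    let σ' , σ'≡ , R = PR d σ τ (lits Γ) Pσ∧τ Γ⊨τ in σ' , σ'≡ , ax R , tt

  completable-∨ : ∀ {d} (Γ Δ : List (Fm (Var d))) {A B τ} →
                  Completable d (Γ ++ A ∷ B ∷ Δ) τ → Completable d (Γ ++ (A ∨' B) ∷ Δ) τ
  completable-∨ Γ Δ F σ Pσ∧τ r = let σ' , σ'≡ , π , f = F σ Pσ∧τ r in σ' , σ'≡ , ∨r Γ Δ π , f

  completable-∀ : ∀ {d} (Γ Δ : List (Fm (Var d))) {A τ} →
                  Completable (d ▷ē) (map (renFm ēold) Γ ++ open1 ēold (var ēnew) A ∷ map (renFm ēold) Δ) τ →
                  Completable d (Γ ++ ∀' A ∷ Δ) τ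
  completable-∀ Γ Δ F σ Pσ∧τ r = let σ' , σ'≡ , π , f = F σ Pσ∧τ r in σ' , σ'≡ , ∀r Γ Δ π , f

  -- the premiss is run from σ↑; its output σ' ≡ε σ↑ ∧ τ projects to σ ∧ τ↓
  completable-∃ : ∀ {d} (Γ Δ : List (Fm (Var d))) {A τ} →
                  Completable (d ▷X) (map (renFm Xold) Γ ++ open1 Xold (var Xnew) A ∷ renFm Xold (∃' A)
                                        ∷ map (renFm Xold) Δ) τ →
                  Completable d (Γ ++ ∃' A ∷ Δ) (proj d τ)
  completable-∃ {d} Γ Δ {τ = τ} F σ Pσ∧τ↓ r =
    let projection = proj-lift-meet d σ τ
        Pσ↑∧τ = Equivalence.from (P1 d _) (P2 d _ _ Pσ∧τ↓ (proj₂ projection))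
        σ' , (σ'≼ , ≼σ') , π , f = F (lift d σ) Pσ↑∧τ r
    in proj d σ' , ≡ε-trans d (proj-mono d σ'≼ , proj-mono d ≼σ') projection , ∃r Γ Δ π , f

  -- The ∧ rule with premisses in the order i: the first premiss is run from
  -- σ and reaches σ₁ ≡ε σ ∧ τa, the second from σ₁ and reaches σ₁ ∧ τb,
  -- which is equivalent to σ ∧ τ whenever τ ≡ε τa ∧ τb.
  ∧-step : ∀ {d} (Γ Δ : List (Fm (Var d))) {A₀ A₁ : Fm (Var d)} {τa τb τ : Ψ d} (i : Bool) →
           Completable d (Γ ++ pick i A₀ A₁ ∷ Δ) τa → Completable d (Γ ++ pick (not i) A₀ A₁ ∷ Δ) τb →
           ≡ε d τ (∧ᶜ d τa τb) → (σ : Ψ d) → P d (∧ᶜ d σ τ) → (r : Sequentialisation) →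
           (i ≡ false × r [] ≡ white) ⊎ (i ≡ true × r [] ≡ black) →
           Reaches d σ (Γ ++ (A₀ ∧' A₁) ∷ Δ) τ r
  ∧-step {d} Γ Δ {τa = τa} {τb} {τ} i Fa Fb (τ≼ , ≼τ) σ Pσ∧τ r colour =
    let σ∧τ≼σ∧τa : ≼ε d (∧ᶜ d σ τ) (∧ᶜ d σ τa)
        σ∧τ≼σ∧τa = ∧-greatest d (∧-lowerˡ d) (≼-trans d (∧-lowerʳ d) (≼-trans d τ≼ (∧-lowerˡ d)))
        σ₁ , (σ₁≼ , ≼σ₁) , π₁ , f₁ = Fa σ (P2 d _ _ Pσ∧τ σ∧τ≼σ∧τa) (leftSub r)
        σ∧τ≼σ₁∧τb : ≼ε d (∧ᶜ d σ τ) (∧ᶜ d σ₁ τb)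
        σ∧τ≼σ₁∧τb = ∧-greatest d (≼-trans d σ∧τ≼σ∧τa ≼σ₁)
                                 (≼-trans d (∧-lowerʳ d) (≼-trans d τ≼ (∧-lowerʳ d)))
        σ₁∧τb≼σ∧τ : ≼ε d (∧ᶜ d σ₁ τb) (∧ᶜ d σ τ)
        σ₁∧τb≼σ∧τ = ∧-greatest d (≼-trans d (∧-lowerˡ d) (≼-trans d σ₁≼ (∧-lowerˡ d)))
                      (≼-trans d (∧-greatest d (≼-trans d (∧-lowerˡ d) (≼-trans d σ₁≼ (∧-lowerʳ d)))
                                               (∧-lowerʳ d)) ≼τ)
        σ₂ , (σ₂≼ , ≼σ₂) , π₂ , f₂ = Fb σ₁ (P2 d _ _ Pσ∧τ σ∧τ≼σ₁∧τb) (rightSub r)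
    in σ₂ , (≼-trans d σ₂≼ σ₁∧τb≼σ∧τ , ≼-trans d σ∧τ≼σ₁∧τb ≼σ₂) , ∧r Γ Δ i π₁ π₂ , f₁ , f₂ , colour

  -- the colour of the root of r decides which premiss is derived first
  completable-∧ : ∀ {d} (Γ Δ : List (Fm (Var d))) {A₀ A₁ τ₀ τ₁} →
                  Completable d (Γ ++ A₀ ∷ Δ) τ₀ → Completable d (Γ ++ A₁ ∷ Δ) τ₁ →
                  Completable d (Γ ++ (A₀ ∧' A₁) ∷ Δ) (∧ᶜ d τ₀ τ₁)
  completable-∧ {d} Γ Δ F₀ F₁ σ Pσ∧τ r with r [] in root
  ... | white = ∧-step Γ Δ false F₀ F₁ (≡ε-refl d) σ Pσ∧τ r (inj₁ (refl , root))
  ... | black = ∧-step Γ Δ true F₁ F₀ (∧-comm d) σ Pσ∧τ r (inj₂ (refl , root))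

  -- Every LK1 derivation of an instance ρΓ yields a residual τ for Γ that is
  -- compatible with ρ; the residual is built rule by rule: from (Rel) at
  -- axioms, as a meet at ∧ rules and as a projection at ∃ rules.
  complete : ∀ {d Δ} → LK1 (neig d) Δ → (ρ : Inst d) (Γ : List (Fm (Var d))) → map (instFm ρ) Γ ≡ Δ →
             Σ (Ψ d) λ τ → ε d ρ τ × Completable d Γ τ
  complete {d} (ax v) ρ Γ refl =
    let τ , Γ⊨τ , e = Equivalence.to (Rel d (lits Γ) ρ) (subst (⊨ _) (lits-inst ρ Γ) v)
    in τ , e , completable-ax Γ⊨τ
  complete {d} (∧r _ _ q₀ q₁) ρ Γ eq with map-focus-inv (instFm ρ) Γ eq
  ... | Γa , Y , Δa , refl , refl , eqY , refl with substFm-∧-inv Y eqY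
  ...   | Y₀ , Y₁ , refl , refl , refl =
    let τ₀ , e₀ , F₀ = complete q₀ ρ (Γa ++ Y₀ ∷ Δa) (map-++ (instFm ρ) Γa _)
        τ₁ , e₁ , F₁ = complete q₁ ρ (Γa ++ Y₁ ∷ Δa) (map-++ (instFm ρ) Γa _)
    in ∧ᶜ d τ₀ τ₁ , meet-intro d e₀ e₁ , completable-∧ Γa Δa F₀ F₁
  complete (∨r _ _ q) ρ Γ eq with map-focus-inv (instFm ρ) Γ eq
  ... | Γa , Y , Δa , refl , refl , eqY , refl with substFm-∨-inv Y eqY
  ...   | Y₀ , Y₁ , refl , refl , refl =
    let τ , e , F = complete q ρ (Γa ++ Y₀ ∷ Y₁ ∷ Δa) (map-++ (instFm ρ) Γa _)
    in τ , e , completable-∨ Γa Δa F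
  complete {d} (∃r _ _ t q) ρ Γ eq with map-focus-inv (instFm ρ) Γ eq
  ... | Γa , Y , Δa , refl , refl , eqY , refl with substFm-∃-inv Y eqY
  ...   | Y₀ , refl , refl =
    let τ , e , F = complete {d ▷X} q (ρ , t) _ (premiseX-inst ρ t Γa Δa Y₀)
    in proj d τ , Proj d ρ τ t e , completable-∃ Γa Δa F
  complete {d} (∀r _ _ q) ρ Γ eq with map-focus-inv (instFm ρ) Γ eq
  ... | Γa , Y , Δa , refl , refl , eqY , refl with substFm-∀-inv Y eqY
  ...   | Y₀ , refl , refl =
    let τ , e , F = complete {d ▷ē} q ρ _ (premiseē-inst ρ Γa Δa Y₀)
    in τ , e , completable-∀ Γa Δa F

theorem5 : (S : Signature) (C : Syntax.ConstraintStructure S) →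
    let open Syntax S in
    let open CS C in
    Axioms → (Γ : List (Fm (Var d₀))) →
    -- (1)
    ((σ σ' : Ψ d₀) → SDI d₀ σ Γ σ' → ε d₀ tt σ' → LK1 0 (map (instFm tt) Γ))
    -- (2)
    × (((d : Dom) (σ : Ψ d) → P d σ ⇔ Satisfiable d σ) →
       (σ σ' : Ψ d₀) → SDI d₀ σ Γ σ' → LK1 0 (map (instFm tt) Γ))
    -- (3)
    × ((((d : Dom) (σ : Ψ d) → P d σ) ⊎ ((d : Dom) (σ : Ψ d) → P d σ ⇔ Satisfiable d σ)) →
       LK1 0 (map (instFm tt) Γ) →
       (σ : Ψ d₀) → ε d₀ tt σ → (r : Sequentialisation) →
       Σ (Ψ d₀) λ σ' → ε d₀ tt σ' × Σ (SDI d₀ σ Γ σ') λ π → follows π r)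
theorem5 S C AX Γ = part1 , part2 , part3
  where
  open Syntax S
  open CS C
  open ConstraintCalculus S C AX
  open Soundness S C AX
  open Completeness S C AX

  part1 : (σ σ' : Ψ d₀) → SDI d₀ σ Γ σ' → ε d₀ tt σ' → LK1 0 (map (instFm tt) Γ)
  part1 σ σ' π e = proj₂ (sound π tt e)

  -- satisfiability of the output constraint is exactly P
  part2 : ((d : Dom) (σ : Ψ d) → P d σ ⇔ Satisfiable d σ) →
          (σ σ' : Ψ d₀) → SDI d₀ σ Γ σ' → LK1 0 (map (instFm tt) Γ)
  part2 P⇔sat σ σ' π = part1 σ σ' π (proj₂ (Equivalence.to (P⇔sat d₀ σ') (output-P π)))

  P-compatible : ((d : Dom) (σ : Ψ d) → P d σ) ⊎ ((d : Dom) (σ : Ψ d) → P d σ ⇔ Satisfiable d σ) →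
                 (d : Dom) (ρ : Inst d) (σ : Ψ d) → ε d ρ σ → P d σ
  P-compatible (inj₁ always) d ρ σ e = always d σ
  P-compatible (inj₂ P⇔sat) d ρ σ e = Equivalence.from (P⇔sat d σ) (ρ , e)

  part3 : ((d : Dom) (σ : Ψ d) → P d σ) ⊎ ((d : Dom) (σ : Ψ d) → P d σ ⇔ Satisfiable d σ) →
          LK1 0 (map (instFm tt) Γ) → (σ : Ψ d₀) → ε d₀ tt σ → (r : Sequentialisation) →
          Σ (Ψ d₀) λ σ' → ε d₀ tt σ' × Σ (SDI d₀ σ Γ σ') λ π → follows π r
  part3 choice ⊢Γ σ e r =
    let τ , eτ , F = complete {d₀} ⊢Γ tt Γ refl
        e∧ = meet-intro d₀ e eτ
        σ' , (_ , ≼σ') , derivation = F σ (P-compatible choice d₀ tt _ e∧) r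
    in σ' , ≼σ' tt e∧ , derivation
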